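{- If $s \geq r \geq 2$ are integers, then $\operatorname{OR}^2(\diamond_s,\diamond_r) = \operatorname{CR}^2(\diamond_s,\diamond_r) > 2s+2$.
   Context: The $r$-diamond $\diamond_r$ is the Hasse diagram of the poset $\{x,y_1,\dots,y_r,z\}$ with $x\le y_i\le z$: a 2-uniform pograph with edges $xy_i$ and $y_iz$. Given a coloring of the comparable pairs of a poset $Q$, a copy of $H$ in color $i$ is an injection $f:V(H)\to Q$ with $f(x)\le f(y)$ whenever $x\le y$ such that every edge of $H$ is mapped to a pair of color $i$. $\operatorname{CR}^2(G_1,G_2)$ is the least $N$ such that every 2-coloring of the comparable pairs of the $N$-element chain $C_N$ contains a copy of $G_1$ in color 1 or of $G_2$ in color 2. $\operatorname{OR}^2(\diamond_s,\diamond_r)$ is the ordered Ramsey number of the ordered graphs obtained from $\diamond_s,\diamond_r$ by extending their partial orders to total orders (all such extensions are isomorphic): the least $N$ such that every 2-coloring of the edges of the complete graph on $\{1,\dots,N\}$ contains an order-preserving copy of the first in color 1 or of the second in color 2. -}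

module Defs where

open import Data.Nat using (ℕ; zero; suc; _≤_; _<_)
open import Data.Fin using (Fin; toℕ)
import Data.Fin as F
open import Data.Product using (Σ; _×_)
open import Data.Sum using (_⊎_)
open import Relation.Nullary using (¬_)
open import Relation.Binary.PropositionalEquality using (_≡_)
open import Function.Definitions using (Injective)

-- Vertices of the r-diamond: x (bot), y_1..y_r (mid j), z (top).
data DV (r : ℕ) : Set where
  bot : DV r
  mid : Fin r → DV r
  top : DV r

data _≼_ {r : ℕ} : DV r → DV r → Set where
  refl-≼  : ∀ {u} → u ≼ u
  bot≼    : ∀ {u} → bot ≼ u
  ≼top    : ∀ {u} → u ≼ top

data Edge {r : ℕ} : DV r → DV r → Set where
  lower : (j : Fin r) → Edge bot (mid j)
  upper : (j : Fin r) → Edge (mid j) top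

-- The total order extension x < y_1 < ... < y_r < z, via a rank.
rank : ∀ {r} → DV r → ℕ
rank bot = 0
rank (mid j) = suc (toℕ j)
rank {r} top = suc r

-- A 2-colouring of the comparable pairs {a < b} of the chain C_N
-- (equivalently of the edges of the complete graph on {1..N}):
-- c a b is the colour of the pair with a < b; values with a ≥ b are irrelevant.
-- Colour 1 of the paper is F.zero, colour 2 is F.suc F.zero.
Coloring : ℕ → Set
Coloring N = Fin N → Fin N → Fin 2

ChainCopy : (r N : ℕ) → Coloring N → Fin 2 → Set
ChainCopy r N c i =
  Σ (DV r → Fin N) λ f →
    Injective _≡_ _≡_ f ×
    (∀ {u v} → u ≼ v → f u F.≤ f v) ×
    (∀ {u v} → Edge u v → c (f u) (f v) ≡ i)

OrderedCopy : (r N : ℕ) → Coloring N → Fin 2 → Set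
OrderedCopy r N c i =
  Σ (DV r → Fin N) λ f →
    Injective _≡_ _≡_ f ×
    (∀ {u v} → rank u ≤ rank v → f u F.≤ f v) ×
    (∀ {u v} → Edge u v → c (f u) (f v) ≡ i)

ChainArrows : (s r N : ℕ) → Set
ChainArrows s r N = (c : Coloring N) → ChainCopy s N c F.zero ⊎ ChainCopy r N c (F.suc F.zero)

OrderedArrows : (s r N : ℕ) → Set
OrderedArrows s r N = (c : Coloring N) → OrderedCopy s N c F.zero ⊎ OrderedCopy r N c (F.suc F.zero)

IsLeast : (ℕ → Set) → ℕ → Set
IsLeast P N = P N × (∀ M → M < N → ¬ P M)

IsCR2 : (s r N : ℕ) → Set
IsCR2 s r N = IsLeast (ChainArrows s r) N

IsOR2 : (s r N : ℕ) → Set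
IsOR2 s r N = IsLeast (OrderedArrows s r) N

-- A colouring of C_N contains ◇_r in colour i (as a chain copy or as an ordered copy alike)
-- iff there are a < b with r vertices m strictly between them such that am and mb both have
-- colour i.  This property is decidable, so the least N arrowing (◇_s, ◇_r) exists as soon as
-- some N does, and one does by Ramsey's theorem, since a monochromatic clique on r + 2
-- increasing vertices yields a diamond with r midpoints.  For N ≤ 2s + 2, colour a pair red
-- iff it lies inside {0,…,s} or inside {s+1,…,N-1}: a red diamond with s midpoints spans
-- s + 2 vertices of one half, and a blue one would need a < m < b alternating halves.

module Submission where

open import Defs
open import Data.Bool using (Bool; true; false; T; if_then_else_)
import Data.Bool.Properties as BoolP
open import Data.Empty using (⊥)
open import Data.Fin as F using (Fin; toℕ; punchIn; punchOut; inject₁; fromℕ)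
import Data.Fin.Properties as FinP
open import Data.Nat using (ℕ; zero; suc; _≤_; _<_; _+_; _*_; z≤n; s≤s; _≤?_; _≤ᵇ_)
open import Data.Nat.Properties
open import Data.Nat.Tactic.RingSolver using (solve-∀)
open import Data.Product using (Σ; _×_; _,_; proj₁; proj₂)
open import Data.Sum using (_⊎_; inj₁; inj₂; [_,_]′)
import Data.Sum as Sum
open import Data.Vec.Functional using (Vector; _∷_; head; tail)
open import Data.Vec.Functional.Relation.Binary.Pointwise using (Pointwise)
open import Function using (_∘_; Equivalence)
open import Function.Definitions using (Injective)
open import Level using (0ℓ)
open import Relation.Binary.Core using (Rel; _Preserves_⟶_)
open import Relation.Binary.Definitions using (Reflexive; _Respects_; tri<; tri≈; tri>)
open import Relation.Binary.PropositionalEquality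
open import Relation.Nullary using (Dec; does; yes; no; ¬_; ¬?; contradiction)
open import Relation.Nullary.Decidable using (_×-dec_; _⊎-dec_)
open import Relation.Unary using (Pred; Decidable)

count : ∀ {M} {P : Pred (Fin M) 0ℓ} → Decidable P → ℕ
count {zero}  P? = 0
count {suc M} P? with P? F.zero
... | yes _ = suc (count (P? ∘ F.suc))
... | no  _ = count (P? ∘ F.suc)

Increasing : ∀ {n M} → (Fin n → Fin M) → Set
Increasing h = h Preserves F._<_ ⟶ F._<_

increasing⇒injective : ∀ {n M} {h : Fin n → Fin M} → Increasing h → Injective _≡_ _≡_ h
increasing⇒injective {h = h} h↑ {x} {y} hx≡hy with FinP.<-cmp x y
... | tri< x<y _ _ = contradiction (h↑ x<y) (FinP.<-irrefl hx≡hy)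
... | tri≈ _ x≡y _ = x≡y
... | tri> _ _ y<x = contradiction (h↑ y<x) (FinP.<-irrefl (sym hx≡hy))

cons₀ : ∀ {n M} → (Fin n → Fin M) → Fin (suc n) → Fin (suc M)
cons₀ h F.zero    = F.zero
cons₀ h (F.suc j) = F.suc (h j)

cons₀-increasing : ∀ {n M} {h : Fin n → Fin M} → Increasing h → Increasing (cons₀ h)
cons₀-increasing h↑ {F.zero}  {F.suc j} _         = s≤s z≤n
cons₀-increasing h↑ {F.suc i} {F.suc j} (s≤s i<j) = s≤s (h↑ i<j)

enumerate : ∀ {M n} {P : Pred (Fin M) 0ℓ} (P? : Decidable P) → n ≤ count P? →
  Σ (Fin n → Fin M) λ h → Increasing h × (∀ j → P (h j))
enumerate {zero} {zero} _ _ = (λ ()) , (λ { {()} }) , (λ ())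
enumerate {suc M} P? n≤ with P? F.zero
enumerate {suc M} {zero} P? _ | yes _ = (λ ()) , (λ { {()} }) , (λ ())
enumerate {suc M} {suc n} P? (s≤s n≤) | yes P0 with enumerate (P? ∘ F.suc) n≤
... | h , h↑ , Ph = cons₀ h , cons₀-increasing h↑ , λ { F.zero → P0 ; (F.suc j) → Ph j }
enumerate {suc M} P? n≤ | no _ with enumerate (P? ∘ F.suc) n≤
... | h , h↑ , Ph = F.suc ∘ h , s≤s ∘ h↑ , Ph

count-suc≤count : ∀ {M} {P : Pred (Fin (suc M)) 0ℓ} (P? : Decidable P) → count (P? ∘ F.suc) ≤ count P?
count-suc≤count P? with P? F.zero
... | yes _ = n≤1+n _
... | no  _ = ≤-refl

injection⇒≤count : ∀ {M n} {P : Pred (Fin M) 0ℓ} (P? : Decidable P) (g : Fin n → Fin M) →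
  Injective _≡_ _≡_ g → (∀ j → P (g j)) → n ≤ count P?

injection-avoiding-0⇒≤count : ∀ {M n} {P : Pred (Fin (suc M)) 0ℓ} (P? : Decidable P)
  (g : Fin n → Fin (suc M)) → Injective _≡_ _≡_ g → (∀ j → F.zero ≢ g j) → (∀ j → P (g j)) →
  n ≤ count (P? ∘ F.suc)
injection-avoiding-0⇒≤count {P = P} P? g g-inj 0∉g Pg =
  injection⇒≤count (P? ∘ F.suc) (λ j → punchOut (0∉g j))
    (λ e → g-inj (FinP.punchOut-injective (0∉g _) (0∉g _) e))
    (λ j → subst P (sym (FinP.punchIn-punchOut (0∉g j))) (Pg j))

injection⇒≤count {n = zero} _ _ _ _ = z≤n
injection⇒≤count {zero} {suc n} _ g _ _ with g F.zero
... | ()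
injection⇒≤count {suc M} {suc n} {P} P? g g-inj Pg with FinP.any? (λ j → F.zero FinP.≟ g j)
... | no 0∉g = ≤-trans (injection-avoiding-0⇒≤count P? g g-inj (λ j 0≡gj → 0∉g (j , 0≡gj)) Pg)
                       (count-suc≤count P?)
... | yes (j , 0≡gj) with P? F.zero
...   | no ¬P0 = contradiction (subst P (sym 0≡gj) (Pg j)) ¬P0
...   | yes _  = s≤s (injection-avoiding-0⇒≤count P? (g ∘ punchIn j)
                        (FinP.punchIn-injective j _ _ ∘ g-inj)
                        (λ k 0≡g → FinP.punchInᵢ≢i j k (g-inj (trans (sym 0≡g) 0≡gj)))
                        (Pg ∘ punchIn j))

count-mono : ∀ {M} {P Q : Pred (Fin M) 0ℓ} (P? : Decidable P) (Q? : Decidable Q) →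
  (∀ {x} → P x → Q x) → count P? ≤ count Q?
count-mono P? Q? P⇒Q with enumerate P? ≤-refl
... | h , h↑ , Ph = injection⇒≤count Q? h (increasing⇒injective h↑) (P⇒Q ∘ Ph)

count+count-∁ : ∀ {M} {P : Pred (Fin M) 0ℓ} (P? : Decidable P) → count P? + count (¬? ∘ P?) ≡ M
count+count-∁ {zero}  P? = refl
count+count-∁ {suc M} P? with P? F.zero
... | yes _ = cong suc (count+count-∁ (P? ∘ F.suc))
... | no  _ = trans (+-suc _ _) (cong suc (count+count-∁ (P? ∘ F.suc)))

count-or-count-∁ : ∀ {M} {P : Pred (Fin M) 0ℓ} (P? : Decidable P) a b → a + b ≤ M →
  a ≤ count P? ⊎ b ≤ count (¬? ∘ P?)
count-or-count-∁ P? a b a+b≤M with a ≤? count P? | b ≤? count (¬? ∘ P?)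
... | yes a≤ | _      = inj₁ a≤
... | no _   | yes b≤ = inj₂ b≤
... | no a≰  | no b≰  = contradiction (≤-trans a+b≤M (≤-reflexive (sym (count+count-∁ P?))))
                          (<⇒≱ (+-mono-< (≰⇒> a≰) (≰⇒> b≰)))

red blue : Fin 2
red  = F.zero
blue = F.suc F.zero

≢red⇒≡blue : ∀ {i : Fin 2} → i ≢ red → i ≡ blue
≢red⇒≡blue {F.zero}       i≢red = contradiction refl i≢red
≢red⇒≡blue {F.suc F.zero} _     = refl

restrict : ∀ {M K} → Coloring M → (Fin K → Fin M) → Coloring K
restrict c g x y = c (g x) (g y)

Clique : ∀ {M} → Coloring M → Fin 2 → ℕ → Set
Clique {M} c i n = Σ (Fin n → Fin M) λ h → Increasing h × (∀ {j k} → j F.< k → c (h j) (h k) ≡ i)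

clique₀ : ∀ {M} {c : Coloring M} {i} → Clique c i 0
clique₀ = (λ ()) , (λ { {()} }) , (λ { {()} })

clique-restrict : ∀ {M K} (c : Coloring M) (g : Fin K → Fin M) {i n} → Increasing g →
  Clique (restrict c g) i n → Clique c i n
clique-restrict c g g↑ (h , h↑ , ch) = g ∘ h , g↑ ∘ h↑ , ch

clique-cons₀ : ∀ {M} (c : Coloring (suc M)) {i n} (K : Clique (restrict c F.suc) i n) →
  (∀ j → c F.zero (F.suc (proj₁ K j)) ≡ i) → Clique c i (suc n)
clique-cons₀ c {i} (h , h↑ , ch) c₀h≡i = cons₀ h , cons₀-increasing h↑ , edges
  where
  edges : ∀ {j k} → j F.< k → c (cons₀ h j) (cons₀ h k) ≡ i
  edges {F.zero}  {F.suc k} _         = c₀h≡i k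
  edges {F.suc j} {F.suc k} (s≤s j<k) = ch j<k

ramseyBound : ℕ → ℕ → ℕ
ramseyBound zero    b       = 0
ramseyBound (suc a) zero    = 0
ramseyBound (suc a) (suc b) = suc (ramseyBound a (suc b) + ramseyBound (suc a) b)

-- Erdős–Szekeres: the colours of the edges at vertex 0 split the other vertices into a
-- red and a blue neighbourhood, one of which is large enough to recurse into.
ramsey : ∀ a b {M} (c : Coloring M) → ramseyBound a b ≤ M → Clique c red a ⊎ Clique c blue b
ramsey zero    b       c _ = inj₁ (clique₀ {c = c})
ramsey (suc a) zero    c _ = inj₂ (clique₀ {c = c})
ramsey (suc a) (suc b) {suc M} c (s≤s bound)
  with count-or-count-∁ (λ m → c F.zero (F.suc m) FinP.≟ red) _ _ bound
... | inj₁ many-red with enumerate _ many-red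
...   | h , h↑ , red₀ with ramsey a (suc b) (restrict c (F.suc ∘ h)) ≤-refl
...     | inj₁ K = inj₁ (clique-cons₀ c (clique-restrict (restrict c F.suc) h h↑ K) (red₀ ∘ proj₁ K))
...     | inj₂ K = inj₂ (clique-restrict c (F.suc ∘ h) (s≤s ∘ h↑) K)
ramsey (suc a) (suc b) {suc M} c (s≤s bound)
  | inj₂ many-blue with enumerate _ many-blue
...   | h , h↑ , blue₀ with ramsey (suc a) b (restrict c (F.suc ∘ h)) ≤-refl
...     | inj₁ K = inj₁ (clique-restrict c (F.suc ∘ h) (s≤s ∘ h↑) K)
...     | inj₂ K = inj₂ (clique-cons₀ c (clique-restrict (restrict c F.suc) h h↑ K)
                                      (≢red⇒≡blue ∘ blue₀ ∘ proj₁ K))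

Midpoint : ∀ {M} → Coloring M → Fin 2 → Fin M → Fin M → Pred (Fin M) 0ℓ
Midpoint c i a b m = a F.< m × m F.< b × c a m ≡ i × c m b ≡ i

midpoint? : ∀ {M} (c : Coloring M) i a b → Decidable (Midpoint c i a b)
midpoint? c i a b m = (a FinP.<? m) ×-dec (m FinP.<? b) ×-dec (c a m FinP.≟ i) ×-dec (c m b FinP.≟ i)

-- Counting midpoints, rather than exhibiting a copy, makes the property decidable.
Diamond : ∀ {M} → Coloring M → Fin 2 → ℕ → Set
Diamond {M} c i n = Σ (Fin M) λ a → Σ (Fin M) λ b → n ≤ count (midpoint? c i a b)

diamond? : ∀ {M} (c : Coloring M) i n → Dec (Diamond c i n)
diamond? c i n = FinP.any? λ a → FinP.any? λ b → n ≤? count (midpoint? c i a b)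

diamond-resp : ∀ {M} {c c′ : Coloring M} → Pointwise (Pointwise _≡_) c c′ →
  ∀ {i n} → Diamond c i n → Diamond c′ i n
diamond-resp {c = c} {c′} c≗c′ {i} (a , b , n≤) =
  a , b , ≤-trans n≤ (count-mono (midpoint? c i a b) (midpoint? c′ i a b)
    λ (a<m , m<b , am , mb) → a<m , m<b , trans (sym (c≗c′ _ _)) am , trans (sym (c≗c′ _ _)) mb)

clique⇒diamond : ∀ {M n} (c : Coloring M) {i} → Clique c i (suc (suc n)) → Diamond c i n
clique⇒diamond {n = n} c {i} (h , h↑ , ch) =
  h F.zero , h last , injection⇒≤count (midpoint? c i _ _) (h ∘ inner) inner-injective
    (λ j → h↑ (zero<inner j) , h↑ (inner<last j) , ch (zero<inner j) , ch (inner<last j))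
  where
  last : Fin (suc (suc n))
  last = fromℕ (suc n)
  inner : Fin n → Fin (suc (suc n))
  inner = F.suc ∘ inject₁
  inner-injective : Injective _≡_ _≡_ (h ∘ inner)
  inner-injective = FinP.inject₁-injective ∘ FinP.suc-injective ∘ increasing⇒injective h↑
  zero<inner : ∀ j → F.zero {suc n} F.< inner j
  zero<inner j = s≤s z≤n
  inner<last : ∀ j → inner j F.< last
  inner<last j = s≤s (subst₂ _<_ (sym (FinP.toℕ-inject₁ j)) (sym (FinP.toℕ-fromℕ n)) (FinP.toℕ<n j))

mid-injective : ∀ {r} {j k : Fin r} → mid j ≡ mid k → j ≡ k
mid-injective refl = refl

chainCopy⇒diamond : ∀ {r M} (c : Coloring M) {i} → ChainCopy r M c i → Diamond c i r
chainCopy⇒diamond c {i} (f , f-inj , f-mono , f-edge) =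
  f bot , f top ,
  injection⇒≤count (midpoint? c i (f bot) (f top)) (f ∘ mid) (mid-injective ∘ f-inj)
    (λ j → strict bot≼ (λ ()) , strict ≼top (λ ()) , f-edge (lower j) , f-edge (upper j))
  where
  strict : ∀ {u v} → u ≼ v → u ≢ v → f u F.< f v
  strict u≼v u≢v = FinP.≤∧≢⇒< (f-mono u≼v) (u≢v ∘ f-inj)

≼⇒rank≤ : ∀ {r} {u v : DV r} → u ≼ v → rank u ≤ rank v
≼⇒rank≤ refl-≼              = ≤-refl
≼⇒rank≤ bot≼                = z≤n
≼⇒rank≤ {u = bot}   ≼top = z≤n
≼⇒rank≤ {u = mid j} ≼top = s≤s (<⇒≤ (FinP.toℕ<n j))
≼⇒rank≤ {u = top}   ≼top = ≤-refl

rank-injective : ∀ {r} {u v : DV r} → rank u ≡ rank v → u ≡ v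
rank-injective {u = bot}   {bot}   _ = refl
rank-injective {u = mid j} {mid k} e = cong mid (FinP.toℕ-injective (suc-injective e))
rank-injective {u = mid j} {top}   e = contradiction (suc-injective e) (<⇒≢ (FinP.toℕ<n j))
rank-injective {u = top}   {mid k} e = contradiction (suc-injective (sym e)) (<⇒≢ (FinP.toℕ<n k))
rank-injective {u = top}   {top}   _ = refl

orderedCopy⇒chainCopy : ∀ {r M} (c : Coloring M) {i} → OrderedCopy r M c i → ChainCopy r M c i
orderedCopy⇒chainCopy c (f , f-inj , f-mono , f-edge) = f , f-inj , f-mono ∘ ≼⇒rank≤ , f-edge

-- Nonemptiness of the middle layer is what puts the bottom strictly below the top.
diamond⇒orderedCopy : ∀ {r M} (c : Coloring M) {i} → Diamond c i (suc r) → OrderedCopy (suc r) M c i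
diamond⇒orderedCopy {r} {M} c {i} (a , b , r+1≤) with enumerate (midpoint? c i a b) r+1≤
... | h , h↑ , isMid = f , f-inj , f-mono , f-edge
  where
  f : DV (suc r) → Fin M
  f bot     = a
  f (mid j) = h j
  f top     = b
  f-strict : ∀ {u v} → rank u < rank v → f u F.< f v
  f-strict {bot}   {mid j} _         = proj₁ (isMid j)
  f-strict {bot}   {top}   _         = <-trans (proj₁ (isMid F.zero)) (proj₁ (proj₂ (isMid F.zero)))
  f-strict {mid j} {mid k} (s≤s j<k) = h↑ j<k
  f-strict {mid j} {top}   _         = proj₁ (proj₂ (isMid j))
  f-strict {top}   {mid k} (s≤s r+1<k) = contradiction (<-trans r+1<k (FinP.toℕ<n k)) (<-irrefl refl)
  f-strict {top}   {top}   (s≤s r+1<r+1) = contradiction r+1<r+1 (<-irrefl refl)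
  f-inj : Injective _≡_ _≡_ f
  f-inj {u} {v} fu≡fv with <-cmp (rank u) (rank v)
  ... | tri< u<v _ _ = contradiction (f-strict u<v) (FinP.<-irrefl fu≡fv)
  ... | tri≈ _ u≡v _ = rank-injective u≡v
  ... | tri> _ _ v<u = contradiction (f-strict v<u) (FinP.<-irrefl (sym fu≡fv))
  f-mono : ∀ {u v} → rank u ≤ rank v → f u F.≤ f v
  f-mono u≤v with m≤n⇒m<n∨m≡n u≤v
  ... | inj₁ u<v = <⇒≤ (f-strict u<v)
  ... | inj₂ u≡v = ≤-reflexive (cong (toℕ ∘ f) (rank-injective u≡v))
  f-edge : ∀ {u v} → Edge u v → c (f u) (f v) ≡ i
  f-edge (lower j) = proj₁ (proj₂ (proj₂ (isMid j)))
  f-edge (upper j) = proj₂ (proj₂ (proj₂ (isMid j)))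

DiamondArrows : ℕ → ℕ → ℕ → Set
DiamondArrows s r M = (c : Coloring M) → Diamond c red s ⊎ Diamond c blue r

diamondArrows⇒orderedArrows : ∀ {s r M} → DiamondArrows (suc s) (suc r) M →
  OrderedArrows (suc s) (suc r) M
diamondArrows⇒orderedArrows arrows c = Sum.map (diamond⇒orderedCopy c) (diamond⇒orderedCopy c) (arrows c)

orderedArrows⇒chainArrows : ∀ {s r M} → OrderedArrows s r M → ChainArrows s r M
orderedArrows⇒chainArrows arrows c = Sum.map (orderedCopy⇒chainCopy c) (orderedCopy⇒chainCopy c) (arrows c)

chainArrows⇒diamondArrows : ∀ {s r M} → ChainArrows s r M → DiamondArrows s r M
chainArrows⇒diamondArrows arrows c = Sum.map (chainCopy⇒diamond c) (chainCopy⇒diamond c) (arrows c)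

ramsey⇒diamondArrows : ∀ s r → DiamondArrows s r (ramseyBound (suc (suc s)) (suc (suc r)))
ramsey⇒diamondArrows s r c = Sum.map (clique⇒diamond c) (clique⇒diamond c) (ramsey _ _ c ≤-refl)

-- Colourings are functions, so without function extensionality a predicate on them can only be
-- expected to respect pointwise equality.
record Exhaustible (A : Set) (_≈_ : Rel A 0ℓ) : Set₁ where
  field
    ≈-refl : Reflexive _≈_
    all?   : ∀ {P : Pred A 0ℓ} → P Respects _≈_ → Decidable P → Dec (∀ x → P x)

open Exhaustible

fin-exhaustible : ∀ n → Exhaustible (Fin n) _≡_
fin-exhaustible n = record { ≈-refl = refl ; all? = λ _ → FinP.all? }

vector-exhaustible : ∀ {A ≈} n → Exhaustible A ≈ → Exhaustible (Vector A n) (Pointwise ≈)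
≈-refl (vector-exhaustible n E) i = ≈-refl E
all? (vector-exhaustible zero E) {P} resp P? with P? (λ ())
... | yes P[] = yes λ v → resp (λ ()) P[]
... | no ¬P[] = no λ all → ¬P[] (all _)
all? (vector-exhaustible {≈ = _≈_} (suc n) E) {P} resp P?
  with all? E cons-resp (λ x → all? (vector-exhaustible n E) (tail-resp x) (P? ∘ (x ∷_)))
  where
  cons-resp : (λ x → ∀ v → P (x ∷ v)) Respects _≈_
  cons-resp x≈y Px∷ v = resp (λ { F.zero → x≈y ; (F.suc i) → ≈-refl E }) (Px∷ v)
  tail-resp : ∀ x → (P ∘ (x ∷_)) Respects Pointwise _≈_
  tail-resp x v≈w = resp λ { F.zero → ≈-refl E ; (F.suc i) → v≈w i }
... | yes all-cons =
  yes λ v → resp (λ { F.zero → ≈-refl E ; (F.suc i) → ≈-refl E }) (all-cons (head v) (tail v))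
... | no ¬all-cons = no λ all → ¬all-cons λ x v → all (x ∷ v)

diamondArrows? : ∀ s r M → Dec (DiamondArrows s r M)
diamondArrows? s r M = all? colorings (λ c≗c′ → Sum.map (diamond-resp c≗c′) (diamond-resp c≗c′))
  (λ c → diamond? c red s ⊎-dec diamond? c blue r)
  where
  colorings : Exhaustible (Coloring M) (Pointwise (Pointwise _≡_))
  colorings = vector-exhaustible M (vector-exhaustible M (fin-exhaustible 2))

increasing-above : ∀ {n M} {h : Fin n → Fin M} {a} → Increasing h → (∀ j → a < toℕ (h j)) →
  ∀ j → a + suc (toℕ j) ≤ toℕ (h j)
increasing-above {a = a} h↑ a<h F.zero = ≤-trans (≤-reflexive (+-comm a 1)) (a<h F.zero)
increasing-above {h = h} {a} h↑ a<h (F.suc j) = begin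
  a + suc (suc (toℕ j))     ≡⟨ +-suc a (suc (toℕ j)) ⟩
  suc a + suc (toℕ j)       ≤⟨ +-monoˡ-≤ (suc (toℕ j)) (a<h F.zero) ⟩
  toℕ (h F.zero) + suc (toℕ j) ≤⟨ increasing-above (h↑ ∘ s≤s) (λ k → h↑ (s≤s z≤n)) j ⟩
  toℕ (h (F.suc j))         ∎
  where open ≤-Reasoning

midpoints-gap : ∀ {M t} {c : Coloring M} {i a b} → suc t ≤ count (midpoint? c i a b) →
  toℕ a + suc t < toℕ b
midpoints-gap {t = t} {c} {i} {a} {b} t+1≤ with enumerate (midpoint? c i a b) t+1≤
... | h , h↑ , isMid = begin-strict
  toℕ a + suc t                  ≡⟨ cong (λ k → toℕ a + suc k) (sym (FinP.toℕ-fromℕ t)) ⟩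
  toℕ a + suc (toℕ (fromℕ t))    ≤⟨ increasing-above h↑ (proj₁ ∘ isMid) (fromℕ t) ⟩
  toℕ (h (fromℕ t))              <⟨ proj₁ (proj₂ (isMid (fromℕ t))) ⟩
  toℕ b                          ∎
  where open ≤-Reasoning

isLow : ℕ → ∀ {M} → Fin M → Bool
isLow s x = toℕ x ≤ᵇ s

isLow⇒≤ : ∀ s {M} (x : Fin M) → isLow s x ≡ true → toℕ x ≤ s
isLow⇒≤ s x low = ≤ᵇ⇒≤ (toℕ x) s (Equivalence.from BoolP.T-≡ low)

≤⇒isLow : ∀ s {M} (x : Fin M) → toℕ x ≤ s → isLow s x ≡ true
≤⇒isLow s x x≤s = Equivalence.to BoolP.T-≡ (≤⇒≤ᵇ x≤s)

¬isLow⇒> : ∀ s {M} (x : Fin M) → isLow s x ≡ false → s < toℕ x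
¬isLow⇒> s x high = ≰⇒> (λ x≤s → subst T high (≤⇒≤ᵇ x≤s))

isLow-downward : ∀ s {M} {x y : Fin M} → x F.≤ y → isLow s y ≡ true → isLow s x ≡ true
isLow-downward s {x = x} {y} x≤y low-y = ≤⇒isLow s x (≤-trans x≤y (isLow⇒≤ s y low-y))

halves : ℕ → ∀ {M} → Coloring M
halves s x y = if does (isLow s x BoolP.≟ isLow s y) then red else blue

halves-red⇒sameHalf : ∀ s {M} (x y : Fin M) → halves s x y ≡ red → isLow s x ≡ isLow s y
halves-red⇒sameHalf s x y with isLow s x BoolP.≟ isLow s y
... | yes same = λ _ → same
... | no  _    = λ ()

halves-blue⇒otherHalf : ∀ s {M} (x y : Fin M) → halves s x y ≡ blue → isLow s x ≢ isLow s y
halves-blue⇒otherHalf s x y with isLow s x BoolP.≟ isLow s y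
... | yes _     = λ ()
... | no  other = λ _ → other

redMidpoint⇒sameHalf : ∀ s {M n} {a b : Fin M} → suc n ≤ count (midpoint? (halves s) red a b) →
  isLow s a ≡ isLow s b
redMidpoint⇒sameHalf s {a = a} {b} n+1≤ with enumerate (midpoint? (halves s) red a b) n+1≤
... | h , _ , isMid with isMid F.zero
...   | _ , _ , am , mb = trans (halves-red⇒sameHalf s a (h F.zero) am) (halves-red⇒sameHalf s (h F.zero) b mb)

-- Red diamonds span more than s + 1 vertices (midpoints-gap), which neither half has room for.
halves-no-red : ∀ {M s} → M ≤ 2 * suc s + 2 → ¬ Diamond (halves (suc s) {M}) red (suc s)
halves-no-red {M} {s} M≤ (a , b , s+1≤) = bySide (isLow (suc s) a) refl
  where
  open ≤-Reasoning
  gap : toℕ a + suc s < toℕ b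
  gap = midpoints-gap s+1≤
  double-plus-two : ∀ s → 2 * suc s + 2 ≡ suc (suc (suc s) + suc s)
  double-plus-two = solve-∀
  bySide : ∀ side → isLow (suc s) a ≡ side → ⊥
  bySide true low-a = <⇒≱ (≤-<-trans (m≤n+m (suc s) (toℕ a)) gap)
    (isLow⇒≤ (suc s) b (trans (sym (redMidpoint⇒sameHalf (suc s) {a = a} {b} s+1≤)) low-a))
  bySide false high-a = <-irrefl refl (begin-strict
    toℕ b                      <⟨ FinP.toℕ<n b ⟩
    M                          ≤⟨ M≤ ⟩
    2 * suc s + 2              ≡⟨ double-plus-two s ⟩
    suc (suc (suc s) + suc s)  ≤⟨ s≤s (+-monoˡ-≤ (suc s) (¬isLow⇒> (suc s) a high-a)) ⟩
    suc (toℕ a + suc s)        ≤⟨ gap ⟩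
    toℕ b                      ∎)

-- The low half is an initial segment, so a blue path x < y < z would have to leave it and return.
halves-no-blue-path : ∀ s {M} {x y z : Fin M} → x F.< y → y F.< z →
  halves s x y ≡ blue → halves s y z ≡ blue → ⊥
halves-no-blue-path s {x = x} {y} {z} x<y y<z xy yz = bySide (isLow s y) refl
  where
  bySide : ∀ side → isLow s y ≡ side → ⊥
  bySide true  low-y  = halves-blue⇒otherHalf s x y xy
                          (trans (isLow-downward s (<⇒≤ x<y) low-y) (sym low-y))
  bySide false high-y = contradiction (trans (sym high-y) (isLow-downward s (<⇒≤ y<z) low-z)) λ ()
    where
    low-z : isLow s z ≡ true
    low-z = BoolP.¬-not λ z-high → halves-blue⇒otherHalf s y z yz (trans high-y (sym z-high))

halves-no-blue : ∀ {M s r} → ¬ Diamond (halves s {M}) blue (suc r)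
halves-no-blue {s = s} (a , b , r+1≤) with enumerate (midpoint? (halves s) blue a b) r+1≤
... | h , _ , isMid with isMid F.zero
...   | a<m , m<b , am , mb = halves-no-blue-path s a<m m<b am mb

halves-not-arrows : ∀ {M s r} → M ≤ 2 * suc s + 2 → ¬ DiamondArrows (suc s) (suc r) M
halves-not-arrows M≤ arrows = [ halves-no-red M≤ , halves-no-blue ]′ (arrows (halves _))

least-below : ∀ {P : ℕ → Set} → (∀ n → Dec (P n)) → ∀ n →
  Σ ℕ (IsLeast P) ⊎ (∀ m → m < n → ¬ P m)
least-below P? zero = inj₂ λ _ ()
least-below P? (suc n) with least-below P? n
... | inj₁ least = inj₁ least
... | inj₂ none with P? n
...   | yes Pn = inj₁ (n , Pn , none)
...   | no ¬Pn = inj₂ λ m m<n+1 → [ none m , (λ { refl → ¬Pn }) ]′ (m<1+n⇒m<n∨m≡n m<n+1)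

least-exists : ∀ {P : ℕ → Set} → (∀ n → Dec (P n)) → ∀ {n} → P n → Σ ℕ (IsLeast P)
least-exists P? {n} Pn with least-below P? (suc n)
... | inj₁ least = least
... | inj₂ none  = contradiction Pn (none n ≤-refl)

isLeast-⇔ : ∀ {P Q : ℕ → Set} → (∀ {n} → P n → Q n) → (∀ {n} → Q n → P n) →
  ∀ {N} → IsLeast P N → IsLeast Q N
isLeast-⇔ P⇒Q Q⇒P (PN , below) = P⇒Q PN , λ M M<N → below M M<N ∘ Q⇒P

proposition3p10 : (s r : ℕ) → 2 ≤ r → r ≤ s →
    Σ ℕ λ N → IsOR2 s r N × IsCR2 s r N × (2 * s + 2 < N)
proposition3p10 (suc s) (suc r) (s≤s _) (s≤s _)
  with least-exists (diamondArrows? (suc s) (suc r)) (ramsey⇒diamondArrows (suc s) (suc r))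
... | N , least =
  N , isLeast-⇔ diamondArrows⇒orderedArrows (chainArrows⇒diamondArrows ∘ orderedArrows⇒chainArrows) least
    , isLeast-⇔ (orderedArrows⇒chainArrows ∘ diamondArrows⇒orderedArrows) chainArrows⇒diamondArrows least
    , ≰⇒> (λ N≤ → halves-not-arrows N≤ (proj₁ least))
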